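{- Let $n \ge 2$, $N = 2^n$, and let $\eta$ be a bijection from the vertex set $\{0,1\}^n$ of the hypercube $Q_n$ to $\mathbb{Z}_N$ (positions on a cycle of length $N$). Fix a coordinate $i \in \{1,\dots,n\}$ and let $H_0 = \{v : v_i = 0\}$ and $H_1 = \{v : v_i = 1\}$ (two complementary copies of $Q_{n-1}$). Let $x, y$ be nonnegative integers with $x + y = 2^{n-1}$. Suppose there is an arc $A$ of $2^{n-1}$ consecutive positions of the cycle such that $|\eta^{ -1}(A) \cap H_0| = x'$ and $|\eta^{ -1}(A) \cap H_1| = y'$ with $|x' - y'| \ge |x - y|$. Then there is an arc $A'$ of $2^{n-1}$ consecutive positions of the cycle with $|\eta^{ -1}(A') \cap H_0| = x$ and $|\eta^{ -1}(A') \cap H_1| = y$.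
   Context: A "diameter" of the cycle $\mathbb{Z}_N$ ($N = 2^n$) divides it into two arcs, each consisting of $2^{n-1}$ consecutive positions $\{j, j+1, \dots, j+2^{n-1}-1\} \pmod N$. For a numbering $\eta$ and complementary subcubes $H_0, H_1$, a split $x'/y'$ means one such arc contains $x'$ vertices of $H_0$ and $y'$ vertices of $H_1$; a split $x'/y'$ is "greater than" $x/y$ when it is at least as unbalanced, i.e. $|x'-y'| \ge |x-y|$. -}

module Defs where

open import Data.Nat using (ℕ; zero; suc; _+_; _^_; _%_)
open import Data.Nat.Properties using ()
open import Data.Bool using (Bool; true; false; if_then_else_)
open import Data.Fin using (Fin; toℕ; fromℕ<)
open import Data.Nat.DivMod using (m%n<n)
open import Data.Vec using (Vec; lookup)
open import Function.Bundles using (_↔_; Inverse)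

Vertex : ℕ → Set
Vertex n = Vec Bool n

N : ℕ → ℕ
N n = 2 ^ n

Numbering : ℕ → Set
Numbering n = Vertex n ↔ Fin (N n)

shift : (n : ℕ) → Fin (N n) → ℕ → Fin (N n)
shift n j k = fromℕ< (m%n<n (toℕ j + k) (N n) {{nz n}})
  where
  open import Data.Nat using (NonZero)
  open import Data.Nat.Properties using (m^n≢0)
  nz : (n : ℕ) → NonZero (2 ^ n)
  nz n = m^n≢0 2 n

count : (ℕ → Bool) → ℕ → ℕ
count p zero = zero
count p (suc m) = count p m + (if p m then 1 else 0)

inHalf : (n : ℕ) → Numbering n → Fin n → Bool → Fin (N n) → ℕ → Bool
inHalf n η i b j k = lookup (Inverse.from η (shift n j k)) i ≡ᵇ b
  where
  _≡ᵇ_ : Bool → Bool → Bool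
  true ≡ᵇ true = true
  false ≡ᵇ false = true
  _ ≡ᵇ _ = false

-- |η⁻¹(A_j) ∩ H_b| where A_j = {j, j+1, …, j + 2^(n-1) - 1} (mod 2^n)
-- and H_b = {v : v_i = b}.
arcCount : (n : ℕ) → Numbering n → Fin n → Bool → Fin (N n) → ℕ
arcCount n η i b j = count (inHalf n η i b j) (2 ^ (n Data.Nat.∸ 1))

-- Let w(t) count the H₀-vertices on the arc of length M = 2^(n-1) starting at position t;
-- shifting the arc by one position changes w by at most one. Flipping coordinate i swaps
-- H₀ and H₁, so |H₀| = M, and the complementary arc starting at t + M has H₀-count
-- M − w(t), which is the H₁-count of the arc at t. For x + y = M, the hypothesis
-- |x − y| ≤ |w(t) − (M − w(t))| puts x between w(t) and w(t + M), so a discrete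
-- intermediate value argument along the cycle yields an arc with w = x.
module Submission where

open import Defs
open import Data.Nat using (ℕ; _+_; _^_; _∸_; _≤_; ∣_-_∣)
open import Data.Bool using (true; false)
open import Data.Fin using (Fin)
open import Data.Product using (∃; _×_; _,_)
open import Relation.Binary.PropositionalEquality using (_≡_)

open import Data.Bool using (Bool; not; if_then_else_)
open import Data.Bool.Properties using (not-involutive)
open import Data.Fin using (toℕ; fromℕ<)
open import Data.Fin.Permutation using (permutation)
open import Data.Fin.Properties using (fromℕ<-cong; fromℕ<-toℕ; toℕ<n; toℕ-fromℕ<)
open import Data.Nat using (zero; suc; _*_; _%_; _/_; _⊓_; z≤n; NonZero)
open import Data.Nat.DivMod using (m%n<n; m<n⇒m%n≡m; [m+n]%n≡m%n; m≡m%n+[m/n]*n)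
open import Data.Nat.Properties
open import Algebra.Properties.CommutativeMonoid.Sum +-0-commutativeMonoid using (sum; sum-permute; sum-cong-≗)
open import Algebra.Properties.CommutativeSemigroup +-commutativeSemigroup using (interchange; x∙yz≈xz∙y; xy∙z≈xz∙y)
open import Data.Sum using (_⊎_; inj₁; inj₂)
open import Data.Vec using (lookup; updateAt)
open import Data.Vec.Properties using (lookup∘updateAt; updateAt-updateAt-local; updateAt-id)
open import Function using (_∘_)
open import Function.Bundles using (Inverse)
open import Relation.Binary.Definitions using (tri<; tri≈; tri>)
open import Relation.Binary.PropositionalEquality using (refl; sym; trans; cong; cong₂; subst; module ≡-Reasoning)
open import Relation.Nullary using (yes; no; contradiction)

ind : Bool → ℕ
ind b = if b then 1 else 0

ind+ind-not : ∀ b → ind b + ind (not b) ≡ 1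
ind+ind-not true = refl
ind+ind-not false = refl

ind≤1 : ∀ b → ind b ≤ 1
ind≤1 true = ≤-refl
ind≤1 false = z≤n

m+m≡n+n⇒m≡n : ∀ {m n} → m + m ≡ n + n → m ≡ n
m+m≡n+n⇒m≡n {m} {n} eq with <-cmp m n
... | tri< m<n _ _ = contradiction eq (<⇒≢ (+-mono-< m<n m<n))
... | tri≈ _ m≡n _ = m≡n
... | tri> _ _ n<m = contradiction (sym eq) (<⇒≢ (+-mono-< n<m n<m))

count-cong : ∀ {p q : ℕ → Bool} m → (∀ k → p k ≡ q k) → count p m ≡ count q m
count-cong zero p≗q = refl
count-cong (suc m) p≗q = cong₂ _+_ (count-cong m p≗q) (cong ind (p≗q m))

count-suc : ∀ (p : ℕ → Bool) m → count p (suc m) ≡ ind (p 0) + count (p ∘ suc) m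
count-suc p zero = +-comm 0 (ind (p 0))
count-suc p (suc m) = begin
  count p (suc m) + ind (p (suc m))                   ≡⟨ cong (_+ ind (p (suc m))) (count-suc p m) ⟩
  ind (p 0) + count (p ∘ suc) m + ind (p (suc m))     ≡⟨ +-assoc (ind (p 0)) _ _ ⟩
  ind (p 0) + count (p ∘ suc) (suc m)                 ∎
  where open ≡-Reasoning

count-+ : ∀ (p : ℕ → Bool) m l → count p (m + l) ≡ count p m + count (λ k → p (m + k)) l
count-+ p m zero = trans (cong (count p) (+-identityʳ m)) (sym (+-identityʳ _))
count-+ p m (suc l) = begin
  count p (m + suc l)                                         ≡⟨ cong (count p) (+-suc m l) ⟩
  count p (m + l) + ind (p (m + l))                           ≡⟨ cong (_+ ind (p (m + l))) (count-+ p m l) ⟩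
  count p m + count (λ k → p (m + k)) l + ind (p (m + l))     ≡⟨ +-assoc (count p m) _ _ ⟩
  count p m + count (λ k → p (m + k)) (suc l)                 ∎
  where open ≡-Reasoning

count+count-not : ∀ (p : ℕ → Bool) m → count p m + count (not ∘ p) m ≡ m
count+count-not p zero = refl
count+count-not p (suc m) = begin
  count p m + ind (p m) + (count (not ∘ p) m + ind (not (p m)))   ≡⟨ interchange (count p m) (ind (p m)) _ _ ⟩
  count p m + count (not ∘ p) m + (ind (p m) + ind (not (p m)))   ≡⟨ cong₂ _+_ (count+count-not p m) (ind+ind-not (p m)) ⟩
  m + 1                                                           ≡⟨ +-comm m 1 ⟩
  suc m                                                           ∎
  where open ≡-Reasoning

count≡sum : ∀ (p : ℕ → Bool) m → count p m ≡ sum (λ (k : Fin m) → ind (p (toℕ k)))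
count≡sum p zero = refl
count≡sum p (suc m) = trans (count-suc p m) (cong (ind (p 0) +_) (count≡sum (p ∘ suc) m))

count≡count-not : ∀ (p : ℕ → Bool) m (σ : Fin m → Fin m) → (∀ k → σ (σ k) ≡ k) →
  (∀ k → p (toℕ (σ k)) ≡ not (p (toℕ k))) → count p m ≡ count (not ∘ p) m
count≡count-not p m σ σσ≗id p∘σ≗not∘p = begin
  count p m                                   ≡⟨ count≡sum p m ⟩
  sum (λ (k : Fin m) → ind (p (toℕ k)))      ≡⟨ sum-permute (λ k → ind (p (toℕ k))) (permutation σ σ σσ≗id σσ≗id) ⟩
  sum (λ (k : Fin m) → ind (p (toℕ (σ k))))  ≡⟨ sum-cong-≗ (cong ind ∘ p∘σ≗not∘p) ⟩
  sum (λ (k : Fin m) → ind (not (p (toℕ k)))) ≡⟨ count≡sum (not ∘ p) m ⟨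
  count (not ∘ p) m                           ∎
  where open ≡-Reasoning

count-not≡half : ∀ (p : ℕ → Bool) M → count p (M + M) ≡ count (not ∘ p) (M + M) →
  count (not ∘ p) (M + M) ≡ M
count-not≡half p M eq = m+m≡n+n⇒m≡n (trans (cong (_+ count (not ∘ p) (M + M)) (sym eq)) (count+count-not p (M + M)))

window : (ℕ → Bool) → ℕ → ℕ → ℕ
window p m t = count (λ l → p (t + l)) m

window-slide : ∀ (p : ℕ → Bool) m t → window p m (suc t) + ind (p t) ≡ window p (suc m) t
window-slide p m t = begin
  window p m (suc t) + ind (p t)                  ≡⟨ +-comm _ (ind (p t)) ⟩
  ind (p t) + window p m (suc t)                  ≡⟨ cong₂ _+_ (cong (ind ∘ p) (sym (+-identityʳ t)))
                                                              (count-cong m (λ l → cong p (sym (+-suc t l)))) ⟩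
  ind (p (t + 0)) + count (λ l → p (t + suc l)) m ≡⟨ count-suc (λ l → p (t + l)) m ⟨
  window p (suc m) t                              ∎
  where open ≡-Reasoning

window-suc≤ : ∀ (p : ℕ → Bool) m t → window p m (suc t) ≤ suc (window p m t)
window-suc≤ p m t = begin
  window p m (suc t)                   ≤⟨ m≤m+n _ (ind (p t)) ⟩
  window p m (suc t) + ind (p t)       ≡⟨ window-slide p m t ⟩
  window p m t + ind (p (t + m))       ≤⟨ +-monoʳ-≤ (window p m t) (ind≤1 (p (t + m))) ⟩
  window p m t + 1                     ≡⟨ +-comm (window p m t) 1 ⟩
  suc (window p m t)                   ∎
  where open ≤-Reasoning

window-+ : ∀ (p : ℕ → Bool) m l t → window p (m + l) t ≡ window p m t + window p l (t + m)
window-+ p m l t = trans (count-+ (λ k → p (t + k)) m l)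
  (cong (window p m t +_) (count-cong l (λ k → cong p (sym (+-assoc t m k)))))

window-not : ∀ (p : ℕ → Bool) m t → window p m t + window (not ∘ p) m t ≡ m
window-not p m t = count+count-not (λ l → p (t + l)) m

Periodic : ∀ {a} {A : Set a} → ℕ → (ℕ → A) → Set a
Periodic P f = ∀ t → f (t + P) ≡ f t

periodic-+* : ∀ {a} {A : Set a} {P} {f : ℕ → A} → Periodic P f → ∀ t k → f (t + k * P) ≡ f t
periodic-+* {f = f} per t zero = cong f (+-identityʳ t)
periodic-+* {P = P} {f} per t (suc k) = begin
  f (t + (P + k * P))    ≡⟨ cong f (x∙yz≈xz∙y t P (k * P)) ⟩
  f (t + k * P + P)      ≡⟨ per (t + k * P) ⟩
  f (t + k * P)          ≡⟨ periodic-+* per t k ⟩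
  f t                    ∎
  where open ≡-Reasoning

periodic-% : ∀ {a} {A : Set a} {P} .{{_ : NonZero P}} {f : ℕ → A} → Periodic P f → ∀ t → f (t % P) ≡ f t
periodic-% {P = P} {f = f} per t =
  trans (sym (periodic-+* per (t % P) (t / P))) (cong f (sym (m≡m%n+[m/n]*n t P)))

window-periodic : ∀ {P} {p : ℕ → Bool} m → Periodic P p → Periodic P (window p m)
window-periodic {P} {p} m per t = count-cong m (λ l → trans (cong p (xy∙z≈xz∙y t P l)) (per (t + l)))

window-full-period : ∀ {P} {p : ℕ → Bool} → Periodic P p → ∀ t → window p P t ≡ count p P
window-full-period per zero = refl
window-full-period {P} {p} per (suc t) = trans (+-cancelʳ-≡ (ind (p t)) _ _ slide) (window-full-period per t)
  where
  slide : window p P (suc t) + ind (p t) ≡ window p P t + ind (p t)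
  slide = trans (window-slide p P t) (cong (λ b → window p P t + ind b) (per t))

discrete-ivt : ∀ (f : ℕ → ℕ) → (∀ t → f (suc t) ≤ suc (f t)) →
  ∀ t L x → f t ≤ x → x ≤ f (t + L) → ∃ λ s → f s ≡ x
discrete-ivt f step t zero x ft≤x x≤f[t+0] = t , ≤-antisym ft≤x (subst (λ u → x ≤ f u) (+-identityʳ t) x≤f[t+0])
discrete-ivt f step t (suc L) x ft≤x x≤f[t+1+L] with x ≤? f (t + L)
... | yes x≤f[t+L] = discrete-ivt f step t L x ft≤x x≤f[t+L]
... | no x≰f[t+L] = t + suc L , ≤-antisym f[t+1+L]≤x x≤f[t+1+L]
  where
  f[t+1+L]≤x : f (t + suc L) ≤ x
  f[t+1+L]≤x = subst (λ u → f u ≤ x) (sym (+-suc t L)) (≤-trans (step (t + L)) (≰⇒> x≰f[t+L]))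

m⊓n+m⊓n+∣m-n∣≡m+n : ∀ m n → m ⊓ n + m ⊓ n + ∣ m - n ∣ ≡ m + n
m⊓n+m⊓n+∣m-n∣≡m+n zero n = refl
m⊓n+m⊓n+∣m-n∣≡m+n (suc m) zero = sym (+-identityʳ (suc m))
m⊓n+m⊓n+∣m-n∣≡m+n (suc m) (suc n) = cong suc (begin
  m ⊓ n + suc (m ⊓ n) + ∣ m - n ∣    ≡⟨ cong (_+ ∣ m - n ∣) (+-suc (m ⊓ n) (m ⊓ n)) ⟩
  suc (m ⊓ n + m ⊓ n + ∣ m - n ∣)    ≡⟨ cong suc (m⊓n+m⊓n+∣m-n∣≡m+n m n) ⟩
  suc (m + n)                        ≡⟨ +-suc m n ⟨
  m + suc n                          ∎)
  where open ≡-Reasoning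

-- With the sum fixed, a smaller difference means a larger minimum.
∣-∣≤⇒between : ∀ {x y a b} → x + y ≡ a + b → ∣ x - y ∣ ≤ ∣ a - b ∣ →
  (a ≤ x × x ≤ b) ⊎ (b ≤ x × x ≤ a)
∣-∣≤⇒between {x} {y} {a} {b} x+y≡a+b ∣x-y∣≤∣a-b∣ = by-order (≤-total a b)
  where
  a⊓b≤x⊓y : a ⊓ b ≤ x ⊓ y
  a⊓b≤x⊓y = ≮⇒≥ λ x⊓y<a⊓b → <⇒≢ (+-mono-<-≤ (+-mono-< x⊓y<a⊓b x⊓y<a⊓b) ∣x-y∣≤∣a-b∣)
    (trans (m⊓n+m⊓n+∣m-n∣≡m+n x y) (trans x+y≡a+b (sym (m⊓n+m⊓n+∣m-n∣≡m+n a b))))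
  between : ∀ {c d} → c ≤ x ⊓ y → x + y ≡ c + d → c ≤ x × x ≤ d
  between {c} {d} c≤x⊓y x+y≡c+d = ≤-trans c≤x⊓y (m⊓n≤m x y) , +-cancelʳ-≤ c x d
    (≤-trans (+-monoʳ-≤ x (≤-trans c≤x⊓y (m⊓n≤n x y))) (≤-reflexive (trans x+y≡c+d (+-comm c d))))
  by-order : a ≤ b ⊎ b ≤ a → (a ≤ x × x ≤ b) ⊎ (b ≤ x × x ≤ a)
  by-order (inj₁ a≤b) = inj₁ (between (subst (_≤ x ⊓ y) (m≤n⇒m⊓n≡m a≤b) a⊓b≤x⊓y) x+y≡a+b)
  by-order (inj₂ b≤a) = inj₂ (between (subst (_≤ x ⊓ y) (m≥n⇒m⊓n≡n b≤a) a⊓b≤x⊓y) (trans x+y≡a+b (+-comm a b)))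

module BalancedWindows (p : ℕ → Bool) (M : ℕ) (periodic : Periodic (M + M) p) (balanced : count p (M + M) ≡ M) where

  window-antipodal : ∀ t → window p M (t + M) ≡ window (not ∘ p) M t
  window-antipodal t = +-cancelˡ-≡ (window p M t) _ _ (begin
    window p M t + window p M (t + M)     ≡⟨ window-+ p M M t ⟨
    window p (M + M) t                    ≡⟨ window-full-period periodic t ⟩
    count p (M + M)                       ≡⟨ balanced ⟩
    M                                     ≡⟨ window-not p M t ⟨
    window p M t + window (not ∘ p) M t   ∎)
    where open ≡-Reasoning

  -- The window count changes by at most one per step and returns to its value after a full turn.
  window-attains : ∀ t x → (window p M t ≤ x × x ≤ window p M (t + M)) ⊎ (window p M (t + M) ≤ x × x ≤ window p M t) →
    ∃ λ s → window p M s ≡ x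
  window-attains t x (inj₁ (lo , hi)) = discrete-ivt (window p M) (window-suc≤ p M) t M x lo hi
  window-attains t x (inj₂ (lo , hi)) = discrete-ivt (window p M) (window-suc≤ p M) (t + M) M x lo
    (subst (x ≤_) (sym full-turn) hi)
    where
    full-turn : window p M (t + M + M) ≡ window p M t
    full-turn = trans (cong (window p M) (+-assoc t M M)) (window-periodic M periodic t)

  split-attained : ∀ t x y → x + y ≡ M → ∣ x - y ∣ ≤ ∣ window p M t - window (not ∘ p) M t ∣ →
    ∃ λ s → window p M s ≡ x × window (not ∘ p) M s ≡ y
  split-attained t x y x+y≡M ∣x-y∣≤ = extend (window-attains t x between)
    where
    open ≡-Reasoning
    between : (window p M t ≤ x × x ≤ window p M (t + M)) ⊎ (window p M (t + M) ≤ x × x ≤ window p M t)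
    between = subst (λ b → (window p M t ≤ x × x ≤ b) ⊎ (b ≤ x × x ≤ window p M t)) (sym (window-antipodal t))
      (∣-∣≤⇒between (trans x+y≡M (sym (window-not p M t))) ∣x-y∣≤)
    extend : (∃ λ s → window p M s ≡ x) → ∃ λ s → window p M s ≡ x × window (not ∘ p) M s ≡ y
    extend (s , ws≡x) = s , ws≡x , +-cancelˡ-≡ x _ _ (begin
      x + window (not ∘ p) M s              ≡⟨ cong (_+ window (not ∘ p) M s) ws≡x ⟨
      window p M s + window (not ∘ p) M s   ≡⟨ window-not p M s ⟩
      M                                     ≡⟨ x+y≡M ⟨
      x + y                                 ∎)

module Hypercube (k : ℕ) (η : Numbering (suc k)) (i : Fin (suc k)) where

  M : ℕ
  M = 2 ^ k

  instance
    N≢0 : NonZero (N (suc k))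
    N≢0 = m^n≢0 2 (suc k)

  N≡M+M : N (suc k) ≡ M + M
  N≡M+M = cong (M +_) (+-identityʳ M)

  position : ℕ → Fin (N (suc k))
  position t = fromℕ< (m%n<n t (N (suc k)))

  position-toℕ : ∀ f → position (toℕ f) ≡ f
  position-toℕ f = trans (fromℕ<-cong _ _ (m<n⇒m%n≡m (toℕ<n f)) _ (toℕ<n f)) (fromℕ<-toℕ f (toℕ<n f))

  coordinate : Fin (N (suc k)) → Bool
  coordinate f = lookup (Inverse.from η f) i

  inH₀ : ℕ → Bool
  inH₀ t = not (coordinate (position t))

  inH₀-periodic : Periodic (N (suc k)) inH₀
  inH₀-periodic t = cong (not ∘ coordinate) (fromℕ<-cong _ _ ([m+n]%n≡m%n t (N (suc k))) _ _)

  antipode : Fin (N (suc k)) → Fin (N (suc k))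
  antipode f = Inverse.to η (updateAt (Inverse.from η f) i not)

  antipode-involutive : ∀ f → antipode (antipode f) ≡ f
  antipode-involutive f = begin
    Inverse.to η (updateAt (Inverse.from η (antipode f)) i not)   ≡⟨ cong (λ v → Inverse.to η (updateAt v i not)) (Inverse.strictlyInverseʳ η _) ⟩
    Inverse.to η (updateAt (updateAt v i not) i not)               ≡⟨ cong (Inverse.to η) flip-flip ⟩
    Inverse.to η v                                                 ≡⟨ Inverse.strictlyInverseˡ η f ⟩
    f                                                              ∎
    where
    open ≡-Reasoning
    v : Vertex (suc k)
    v = Inverse.from η f
    flip-flip : updateAt (updateAt v i not) i not ≡ v
    flip-flip = trans (updateAt-updateAt-local i v (not-involutive (lookup v i))) (updateAt-id i v)

  coordinate-antipode : ∀ f → coordinate (antipode f) ≡ not (coordinate f)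
  coordinate-antipode f = trans (cong (λ v → lookup v i) (Inverse.strictlyInverseʳ η _)) (lookup∘updateAt i (Inverse.from η f))

  H₀-size : count inH₀ (M + M) ≡ M
  H₀-size = count-not≡half (coordinate ∘ position) M
    (subst (λ m → count (coordinate ∘ position) m ≡ count inH₀ m) N≡M+M
      (count≡count-not (coordinate ∘ position) (N (suc k)) antipode antipode-involutive flips))
    where
    flips : ∀ f → coordinate (position (toℕ (antipode f))) ≡ not (coordinate (position (toℕ f)))
    flips f rewrite position-toℕ f | position-toℕ (antipode f) = coordinate-antipode f

  arcCount-H₀ : ∀ j → arcCount (suc k) η i false j ≡ window inH₀ M (toℕ j)
  arcCount-H₀ j = count-cong M on-arc
    where
    -- inHalf tests membership with a Boolean equality local to its definition, hence the case split.
    on-arc : ∀ l → inHalf (suc k) η i false j l ≡ inH₀ (toℕ j + l)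
    on-arc l with coordinate (position (toℕ j + l))
    ... | true = refl
    ... | false = refl

  arcCount-H₁ : ∀ j → arcCount (suc k) η i true j ≡ window (not ∘ inH₀) M (toℕ j)
  arcCount-H₁ j = count-cong M on-arc
    where
    on-arc : ∀ l → inHalf (suc k) η i true j l ≡ not (inH₀ (toℕ j + l))
    on-arc l with coordinate (position (toℕ j + l))
    ... | true = refl
    ... | false = refl

  window-is-arc : ∀ s → ∃ λ j′ →
    (arcCount (suc k) η i false j′ ≡ window inH₀ M s) × (arcCount (suc k) η i true j′ ≡ window (not ∘ inH₀) M s)
  window-is-arc s = position s , arc (arcCount-H₀ _) inH₀-periodic , arc (arcCount-H₁ _) (cong not ∘ inH₀-periodic)
    where
    arc : ∀ {c p} → c ≡ window p M (toℕ (position s)) → Periodic (N (suc k)) p → c ≡ window p M s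
    arc {p = p} c≡ per = trans c≡ (trans (cong (window p M) (toℕ-fromℕ< _)) (periodic-% (window-periodic M per) s))

lemma1 : (n : ℕ) → 2 ≤ n → (η : Numbering n) → (i : Fin n) → (x y : ℕ) →
    x + y ≡ 2 ^ (n ∸ 1) →
    (∃ λ (j : Fin (N n)) → ∣ x - y ∣ ≤ ∣ arcCount n η i false j - arcCount n η i true j ∣) →
    ∃ λ (j′ : Fin (N n)) → (arcCount n η i false j′ ≡ x) × (arcCount n η i true j′ ≡ y)
lemma1 (suc k) _ η i x y x+y≡M (j , ∣x-y∣≤) =
  let (s , w₀≡x , w₁≡y) = split-attained (toℕ j) x y x+y≡M
        (subst (∣ x - y ∣ ≤_) (cong₂ ∣_-_∣ (arcCount-H₀ j) (arcCount-H₁ j)) ∣x-y∣≤)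
      (j′ , arc₀ , arc₁) = window-is-arc s
  in j′ , trans arc₀ w₀≡x , trans arc₁ w₁≡y
  where
  open Hypercube k η i
  open BalancedWindows inH₀ M (subst (λ P → Periodic P inH₀) N≡M+M inH₀-periodic) H₀-size
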